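{- Let $d$ be a positive integer and $0\le k\le n$ integers. Then $$\left\langle \begin{matrix} n\\ k\end{matrix}\right\rangle_d=\det\left(\binom{n+i}{k+j}\right)_{i,j=0}^{d-1}.$$
   Context: For a positive integer $d$ and integer $m\ge0$, $\langle m\rangle_d=\binom{m+d-1}{d}$. For $0\le k\le n$, $\left\langle \begin{matrix} n\\ k\end{matrix}\right\rangle_d=\prod_{j=0}^{k-1}\frac{\langle n-j\rangle_d}{\langle k-j\rangle_d}$. Binomial coefficients $\binom{a}{m}$ with $m<0$ or $m>a$ are $0$. -}

module Defs where

open import Data.Nat as ℕ using (ℕ; zero; suc; _+_; _∸_)
open import Data.Nat.Combinatorics using (_C_)
open import Data.Integer as ℤ using (ℤ; +_)
open import Data.Rational as ℚ using (ℚ; 0ℚ; 1ℚ)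
open import Data.Fin using (Fin; toℕ; punchIn)
import Data.Fin as F

⟨_⟩[_] : ℕ → ℕ → ℕ
⟨ m ⟩[ d ] = (m + d ∸ 1) C d

-- a / b as a rational; the b = 0 branch is never used below
-- (all denominators ⟨k-j⟩_d with j < k are positive).
frac : ℕ → ℕ → ℚ
frac a zero    = 0ℚ
frac a (suc b) = (+ a) ℚ./ suc b

prodUpTo : ℕ → (ℕ → ℚ) → ℚ
prodUpTo zero    f = 1ℚ
prodUpTo (suc k) f = prodUpTo k f ℚ.* f k

dnomial : ℕ → ℕ → ℕ → ℚ
dnomial d n k = prodUpTo k (λ j → frac ⟨ n ∸ j ⟩[ d ] ⟨ k ∸ j ⟩[ d ])

sumFin : (m : ℕ) → (Fin m → ℤ) → ℤ
sumFin zero    f = + 0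
sumFin (suc m) f = f F.zero ℤ.+ sumFin m (λ i → f (F.suc i))

det : (m : ℕ) → (Fin m → Fin m → ℤ) → ℤ
det zero    M = + 1
det (suc m) M =
  sumFin (suc m) (λ j →
    ((ℤ.- (+ 1)) ℤ.^ toℕ j) ℤ.* (M F.zero j ℤ.* det m (λ r c → M (F.suc r) (punchIn j c))))

binomMatrix : (d n k : ℕ) → Fin d → Fin d → ℤ
binomMatrix d n k i j = + ((n + toℕ i) C (k + toℕ j))

-- Write B_d(n, k) = det (C(n+i, k+j))_{i,j<d}. Replacing column j + 1 of this matrix by
-- (k+j+1)·column (j+1) + (k+j−n)·column j multiplies the determinant by (k+1)⋯(k+d) and, by
-- absorption, turns row i into i·C(n+i, k+j); the first row becomes (C(n,k), 0, …, 0), and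
-- after expanding along it row i + 1 is (i+1) times row i of the matrix for (n+1, k):
--   (k+1)⋯(k+d) · B_{d+1}(n, k) = C(n, k) · d! · B_d(n+1, k).
-- Since ⟨a⟩_{d+1}·(d+1) = a·⟨a+1⟩_d = (a+d)·⟨a⟩_d, the products ∏_{j<k} ⟨n−j⟩_d and
-- ∏_{j<k} ⟨k−j⟩_d obey matching recursions in d, and induction on d (with n increasing) gives
--   ∏_{j<k} ⟨k−j⟩_d · B_d(n, k) = ∏_{j<k} ⟨n−j⟩_d.
module Submission where

open import Defs
open import Data.Nat using (ℕ; _≤_)
open import Data.Rational using (ℚ; _/_)
open import Relation.Binary.PropositionalEquality using (_≡_)

open import Data.Nat using (suc; _∸_; _<_; NonZero)
import Data.Nat.Properties as ℕₚ
import Data.Integer as ℤ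
import Data.Integer.Properties as ℤₚ
open import Function using (_∘_)
open import Relation.Binary.PropositionalEquality
  using (refl; sym; trans; cong; cong₂; subst; _≢_; module ≡-Reasoning)

module Products where

  open import Data.Nat using (zero; _+_; _*_; _^_; s≤s; z≤n)
  open import Data.Nat.Properties using (*-identityˡ; *-identityʳ; *-assoc; m*n≢0)
  open import Data.Nat.Tactic.RingSolver using (solve-∀)

  ∏ : ℕ → (ℕ → ℕ) → ℕ
  ∏ zero    f = 1
  ∏ (suc m) f = f 0 * ∏ m (λ i → f (suc i))

  ∏-cong : ∀ m {f g : ℕ → ℕ} → (∀ i → i < m → f i ≡ g i) → ∏ m f ≡ ∏ m g
  ∏-cong zero    f≗g = refl
  ∏-cong (suc m) f≗g = cong₂ _*_ (f≗g 0 (s≤s z≤n)) (∏-cong m (λ i i<m → f≗g (suc i) (s≤s i<m)))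

  ∏-distrib-* : ∀ m (f g : ℕ → ℕ) → ∏ m (λ i → f i * g i) ≡ ∏ m f * ∏ m g
  ∏-distrib-* zero    f g = refl
  ∏-distrib-* (suc m) f g =
    trans (cong (f 0 * g 0 *_) (∏-distrib-* m (λ i → f (suc i)) (λ i → g (suc i))))
          (interchange (f 0) (g 0) _ _)
    where
    interchange : ∀ a b c d → a * b * (c * d) ≡ a * c * (b * d)
    interchange = solve-∀

  ∏-const : ∀ m c → ∏ m (λ _ → c) ≡ c ^ m
  ∏-const zero    c = refl
  ∏-const (suc m) c = cong (c *_) (∏-const m c)

  ∏-last : ∀ m (f : ℕ → ℕ) → ∏ (suc m) f ≡ ∏ m f * f m
  ∏-last zero    f = trans (*-identityʳ (f 0)) (sym (*-identityˡ (f 0)))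
  ∏-last (suc m) f = trans (cong (f 0 *_) (∏-last m (λ i → f (suc i)))) (sym (*-assoc (f 0) _ _))

  ∏-nonZero : ∀ m {f : ℕ → ℕ} → (∀ i → i < m → NonZero (f i)) → NonZero (∏ m f)
  ∏-nonZero zero    f≢0 = _
  ∏-nonZero (suc m) f≢0 =
    m*n≢0 _ _ {{f≢0 0 (s≤s z≤n)}} {{∏-nonZero m (λ i i<m → f≢0 (suc i) (s≤s i<m))}}

open Products

module BinomialIdentities where

  open import Data.Nat using (zero; _+_; _*_; _^_; _!; _>_; s≤s; z≤n; >-nonZero)
  open import Data.Nat.Properties
  open import Data.Nat.Combinatorics using (_C_; nCk+nC[k+1]≡[n+1]C[k+1]; nC1≡n)
  open import Data.Nat.Tactic.RingSolver using (solve-∀)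
  open ≡-Reasoning

  private
    pascal : ∀ n k → suc n C suc k ≡ n C k + n C suc k
    pascal n k = sym (nCk+nC[k+1]≡[n+1]C[k+1] n k)

  -- (k+1)·C(n, k+1) = (n−k)·C(n, k), rearranged so that it holds for all k without truncated subtraction.
  [1+k]*nC[1+k]+k*nCk≡n*nCk : ∀ n k → suc k * (n C suc k) + k * (n C k) ≡ n * (n C k)
  [1+k]*nC[1+k]+k*nCk≡n*nCk zero    zero    = refl
  [1+k]*nC[1+k]+k*nCk≡n*nCk zero    (suc k) = cong₂ _+_ (*-zeroʳ (suc (suc k))) (*-zeroʳ (suc k))
  [1+k]*nC[1+k]+k*nCk≡n*nCk (suc n) zero    =
    trans (+-identityʳ _) (trans (*-identityˡ _) (trans (nC1≡n (suc n)) (sym (*-identityʳ (suc n)))))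
  [1+k]*nC[1+k]+k*nCk≡n*nCk (suc n) (suc k) = begin
      suc (suc k) * (suc n C suc (suc k)) + suc k * (suc n C suc k)
    ≡⟨ cong₂ (λ x y → suc (suc k) * x + suc k * y) (pascal n (suc k)) (pascal n k) ⟩
      suc (suc k) * (b + c) + suc k * (a + b)
    ≡⟨ regroup k a b c ⟩
      (suc (suc k) * c + suc k * b) + (suc k * b + k * a) + (a + b)
    ≡⟨ cong₂ (λ x y → x + y + (a + b))
         ([1+k]*nC[1+k]+k*nCk≡n*nCk n (suc k)) ([1+k]*nC[1+k]+k*nCk≡n*nCk n k) ⟩
      n * b + n * a + (a + b)
    ≡⟨ collect n a b ⟩
      suc n * (a + b)
    ≡⟨ cong (suc n *_) (pascal n k) ⟨
      suc n * (suc n C suc k)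
    ∎
    where
    a = n C k
    b = n C suc k
    c = n C suc (suc k)
    regroup : ∀ k a b c → (2 + k) * (b + c) + (1 + k) * (a + b)
                          ≡ ((2 + k) * c + (1 + k) * b) + ((1 + k) * b + k * a) + (a + b)
    regroup = solve-∀
    collect : ∀ n a b → n * b + n * a + (a + b) ≡ suc n * (a + b)
    collect = solve-∀

  [1+k]*[1+n]C[1+k]≡[1+n]*nCk : ∀ n k → suc k * (suc n C suc k) ≡ suc n * (n C k)
  [1+k]*[1+n]C[1+k]≡[1+n]*nCk n k = +-cancelʳ-≡ (k * (n C k)) _ _ (begin
      suc k * (suc n C suc k) + k * (n C k)
    ≡⟨ cong (λ x → suc k * x + k * (n C k)) (pascal n k) ⟩
      suc k * (n C k + n C suc k) + k * (n C k)
    ≡⟨ regroup k (n C k) (n C suc k) ⟩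
      suc k * (n C k) + (suc k * (n C suc k) + k * (n C k))
    ≡⟨ cong (suc k * (n C k) +_) ([1+k]*nC[1+k]+k*nCk≡n*nCk n k) ⟩
      suc k * (n C k) + n * (n C k)
    ≡⟨ collect k n (n C k) ⟩
      suc n * (n C k) + k * (n C k)
    ∎)
    where
    regroup : ∀ k a b → (1 + k) * (a + b) + k * a ≡ (1 + k) * a + ((1 + k) * b + k * a)
    regroup = solve-∀
    collect : ∀ k n a → (1 + k) * a + n * a ≡ (1 + n) * a + k * a
    collect = solve-∀

  [1+k]*nC[1+k]≡[n∸k]*nCk : ∀ {n k} → k ≤ n → suc k * (n C suc k) ≡ (n ∸ k) * (n C k)
  [1+k]*nC[1+k]≡[n∸k]*nCk {n} {k} k≤n = +-cancelʳ-≡ (k * (n C k)) _ _ (begin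
      suc k * (n C suc k) + k * (n C k)
    ≡⟨ [1+k]*nC[1+k]+k*nCk≡n*nCk n k ⟩
      n * (n C k)
    ≡⟨ cong (_* (n C k)) (m∸n+n≡m k≤n) ⟨
      (n ∸ k + k) * (n C k)
    ≡⟨ *-distribʳ-+ (n C k) (n ∸ k) k ⟩
      (n ∸ k) * (n C k) + k * (n C k)
    ∎)

  k≤n⇒nCk>0 : ∀ {n k} → k ≤ n → n C k > 0
  k≤n⇒nCk>0 {n}     {zero}  _         = s≤s z≤n
  k≤n⇒nCk>0 {suc n} {suc k} (s≤s k≤n) =
    subst (_> 0) (sym (pascal n k)) (≤-trans (k≤n⇒nCk>0 k≤n) (m≤m+n _ _))

  ⟨a⟩[1+d]*[1+d]≡a*⟨1+a⟩[d] : ∀ a d → ⟨ a ⟩[ suc d ] * suc d ≡ a * ⟨ suc a ⟩[ d ]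
  ⟨a⟩[1+d]*[1+d]≡a*⟨1+a⟩[d] a d = begin
      ((a + suc d ∸ 1) C suc d) * suc d
    ≡⟨ cong (λ m → ((m ∸ 1) C suc d) * suc d) (+-suc a d) ⟩
      ((a + d) C suc d) * suc d
    ≡⟨ *-comm _ (suc d) ⟩
      suc d * ((a + d) C suc d)
    ≡⟨ [1+k]*nC[1+k]≡[n∸k]*nCk (m≤n+m d a) ⟩
      (a + d ∸ d) * ((a + d) C d)
    ≡⟨ cong (_* ((a + d) C d)) (m+n∸n≡m a d) ⟩
      a * ⟨ suc a ⟩[ d ]
    ∎

  ⟨a⟩[1+d]*[1+d]≡[a+d]*⟨a⟩[d] : ∀ {a} d → a > 0 → ⟨ a ⟩[ suc d ] * suc d ≡ (a + d) * ⟨ a ⟩[ d ]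
  ⟨a⟩[1+d]*[1+d]≡[a+d]*⟨a⟩[d] {suc b} d _ = begin
      ((b + suc d) C suc d) * suc d
    ≡⟨ cong (λ m → (m C suc d) * suc d) (+-suc b d) ⟩
      (suc (b + d) C suc d) * suc d
    ≡⟨ *-comm _ (suc d) ⟩
      suc d * (suc (b + d) C suc d)
    ≡⟨ [1+k]*[1+n]C[1+k]≡[1+n]*nCk (b + d) d ⟩
      (suc b + d) * ⟨ suc b ⟩[ d ]
    ∎

  ⟨a⟩[d]-nonZero : ∀ {a} d → a > 0 → NonZero ⟨ a ⟩[ d ]
  ⟨a⟩[d]-nonZero {suc b} d _ = >-nonZero (k≤n⇒nCk>0 (m≤n+m d b))

  ∏[1+a+i]*a!≡[a+m]! : ∀ a m → ∏ m (λ i → suc (a + i)) * a ! ≡ (a + m) !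
  ∏[1+a+i]*a!≡[a+m]! a zero    = trans (*-identityˡ (a !)) (cong _! (sym (+-identityʳ a)))
  ∏[1+a+i]*a!≡[a+m]! a (suc m) = begin
      ∏ (suc m) f * a !
    ≡⟨ cong (_* a !) (∏-last m f) ⟩
      ∏ m f * f m * a !
    ≡⟨ swap (∏ m f) (f m) (a !) ⟩
      f m * (∏ m f * a !)
    ≡⟨ cong (f m *_) (∏[1+a+i]*a!≡[a+m]! a m) ⟩
      suc (a + m) !
    ≡⟨ cong _! (+-suc a m) ⟨
      (a + suc m) !
    ∎
    where
    f : ℕ → ℕ
    f i = suc (a + i)
    swap : ∀ x y z → x * y * z ≡ y * (x * z)
    swap = solve-∀

  ∏[n∸i]≡nCk*k! : ∀ {n} k → k ≤ n → ∏ k (λ i → n ∸ i) ≡ (n C k) * k !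
  ∏[n∸i]≡nCk*k! zero    _     = refl
  ∏[n∸i]≡nCk*k! {n} (suc k) 1+k≤n = begin
      ∏ (suc k) (λ i → n ∸ i)
    ≡⟨ ∏-last k (λ i → n ∸ i) ⟩
      ∏ k (λ i → n ∸ i) * (n ∸ k)
    ≡⟨ cong (_* (n ∸ k)) (∏[n∸i]≡nCk*k! k k≤n) ⟩
      (n C k) * k ! * (n ∸ k)
    ≡⟨ swap (n C k) (k !) (n ∸ k) ⟩
      (n ∸ k) * (n C k) * k !
    ≡⟨ cong (_* k !) ([1+k]*nC[1+k]≡[n∸k]*nCk k≤n) ⟨
      suc k * (n C suc k) * k !
    ≡⟨ swap′ (suc k) (n C suc k) (k !) ⟩
      (n C suc k) * suc k !
    ∎
    where
    k≤n = <⇒≤ 1+k≤n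
    swap : ∀ x y z → x * y * z ≡ z * x * y
    swap = solve-∀
    swap′ : ∀ x y z → x * y * z ≡ y * (x * z)
    swap′ = solve-∀

  ∏[k∸i+d]*d!≡[k+d]! : ∀ k d → ∏ k (λ i → k ∸ i + d) * d ! ≡ (k + d) !
  ∏[k∸i+d]*d!≡[k+d]! zero    d = *-identityˡ (d !)
  ∏[k∸i+d]*d!≡[k+d]! (suc k) d =
    trans (*-assoc (suc k + d) (∏ k (λ i → k ∸ i + d)) (d !)) (cong ((suc k + d) *_) (∏[k∸i+d]*d!≡[k+d]! k d))

  -- ⟨n choose k⟩_d = ∏⟨⟩ d n k / ∏⟨⟩ d k k
  ∏⟨⟩ : ℕ → ℕ → ℕ → ℕ
  ∏⟨⟩ d n k = ∏ k (λ j → ⟨ n ∸ j ⟩[ d ])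

  ∏⟨⟩-suc : ∀ d {n} k → k ≤ n → ∏⟨⟩ (suc d) n k * suc d ^ k ≡ (n C k) * k ! * ∏⟨⟩ d (suc n) k
  ∏⟨⟩-suc d {n} k k≤n = begin
      ∏⟨⟩ (suc d) n k * suc d ^ k
    ≡⟨ cong (∏⟨⟩ (suc d) n k *_) (∏-const k (suc d)) ⟨
      ∏⟨⟩ (suc d) n k * ∏ k (λ _ → suc d)
    ≡⟨ ∏-distrib-* k _ _ ⟨
      ∏ k (λ j → ⟨ n ∸ j ⟩[ suc d ] * suc d)
    ≡⟨ ∏-cong k factor ⟩
      ∏ k (λ j → (n ∸ j) * ⟨ suc n ∸ j ⟩[ d ])
    ≡⟨ ∏-distrib-* k _ _ ⟩
      ∏ k (λ j → n ∸ j) * ∏⟨⟩ d (suc n) k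
    ≡⟨ cong (_* ∏⟨⟩ d (suc n) k) (∏[n∸i]≡nCk*k! k k≤n) ⟩
      (n C k) * k ! * ∏⟨⟩ d (suc n) k
    ∎
    where
    factor : ∀ j → j < k → ⟨ n ∸ j ⟩[ suc d ] * suc d ≡ (n ∸ j) * ⟨ suc n ∸ j ⟩[ d ]
    factor j j<k = trans (⟨a⟩[1+d]*[1+d]≡a*⟨1+a⟩[d] (n ∸ j) d)
      (cong (λ m → (n ∸ j) * ⟨ m ⟩[ d ]) (sym (+-∸-assoc 1 (≤-trans (<⇒≤ j<k) k≤n))))

  ∏⟨⟩-suc-diagonal : ∀ d k → ∏⟨⟩ (suc d) k k * suc d ^ k * d ! ≡ (k + d) ! * ∏⟨⟩ d k k
  ∏⟨⟩-suc-diagonal d k = begin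
      ∏⟨⟩ (suc d) k k * suc d ^ k * d !
    ≡⟨ cong (λ x → ∏⟨⟩ (suc d) k k * x * d !) (∏-const k (suc d)) ⟨
      ∏⟨⟩ (suc d) k k * ∏ k (λ _ → suc d) * d !
    ≡⟨ cong (_* d !) (∏-distrib-* k _ _) ⟨
      ∏ k (λ j → ⟨ k ∸ j ⟩[ suc d ] * suc d) * d !
    ≡⟨ cong (_* d !) (∏-cong k factor) ⟩
      ∏ k (λ j → (k ∸ j + d) * ⟨ k ∸ j ⟩[ d ]) * d !
    ≡⟨ cong (_* d !) (∏-distrib-* k _ _) ⟩
      ∏ k (λ j → k ∸ j + d) * ∏⟨⟩ d k k * d !
    ≡⟨ swap (∏ k (λ j → k ∸ j + d)) (∏⟨⟩ d k k) (d !) ⟩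
      ∏ k (λ j → k ∸ j + d) * d ! * ∏⟨⟩ d k k
    ≡⟨ cong (_* ∏⟨⟩ d k k) (∏[k∸i+d]*d!≡[k+d]! k d) ⟩
      (k + d) ! * ∏⟨⟩ d k k
    ∎
    where
    factor : ∀ j → j < k → ⟨ k ∸ j ⟩[ suc d ] * suc d ≡ (k ∸ j + d) * ⟨ k ∸ j ⟩[ d ]
    factor j j<k = ⟨a⟩[1+d]*[1+d]≡[a+d]*⟨a⟩[d] d (m<n⇒0<n∸m j<k)
    swap : ∀ x y z → x * y * z ≡ x * z * y
    swap = solve-∀

open BinomialIdentities

module Determinants where

  open import Data.Nat as ℕ using (zero; _≤?_; _≟_; s≤s; z≤n)
  open import Data.Nat.Properties using (suc-injective; ≤-pred; ≤∧≢⇒<; <⇒≢; n<1+n; ≤-trans; n≤1+n)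
  open import Data.Sum using (inj₁; inj₂)
  open import Data.Fin as Fin using (Fin; toℕ)
  open import Data.Integer using (ℤ; +_; 0ℤ; 1ℤ; -1ℤ; _+_; _*_; _^_)
  open import Data.Integer.Properties using (*-zeroʳ; +-identityʳ; *-identityˡ; *-assoc; *-distribˡ-+; pos-*)
  open import Data.Integer.Tactic.RingSolver using (solve-∀)
  open import Relation.Nullary using (yes; no; contradiction)
  open ≡-Reasoning

  -- ℕ-indexed matrices spare minors and column operations any Fin bookkeeping;
  -- detℕ m only reads the top-left m × m block.
  Matrix : Set
  Matrix = ℕ → ℕ → ℤ

  punchIn : ℕ → ℕ → ℕ
  punchIn zero    c       = suc c
  punchIn (suc j) zero    = zero
  punchIn (suc j) (suc c) = suc (punchIn j c)

  punchOut : ℕ → ℕ → ℕ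
  punchOut zero    zero    = zero
  punchOut zero    (suc c) = c
  punchOut (suc j) zero    = zero
  punchOut (suc j) (suc c) = suc (punchOut j c)

  punchInᵢ≢i : ∀ j c → punchIn j c ≢ j
  punchInᵢ≢i (suc j) (suc c) eq = punchInᵢ≢i j c (suc-injective eq)

  punchIn-punchOut : ∀ {j c} → j ≢ c → punchIn j (punchOut j c) ≡ c
  punchIn-punchOut {zero}  {zero}  j≢c = contradiction refl j≢c
  punchIn-punchOut {zero}  {suc c} j≢c = refl
  punchIn-punchOut {suc j} {zero}  j≢c = refl
  punchIn-punchOut {suc j} {suc c} j≢c = cong suc (punchIn-punchOut (j≢c ∘ cong suc))

  punchOut-punchIn : ∀ j c → punchOut j (punchIn j c) ≡ c
  punchOut-punchIn zero    c       = refl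
  punchOut-punchIn (suc j) zero    = refl
  punchOut-punchIn (suc j) (suc c) = cong suc (punchOut-punchIn j c)

  punchOut-suc : ∀ {j c} → j ≢ c → j ≢ suc c → punchOut j (suc c) ≡ suc (punchOut j c)
  punchOut-suc {zero}        {zero}  j≢c _     = contradiction refl j≢c
  punchOut-suc {zero}        {suc c} _   _     = refl
  punchOut-suc {suc zero}    {zero}  _   j≢1+c = contradiction refl j≢1+c
  punchOut-suc {suc (suc j)} {zero}  _   _     = refl
  punchOut-suc {suc j}       {suc c} j≢c j≢1+c =
    cong suc (punchOut-suc (j≢c ∘ cong suc) (j≢1+c ∘ cong suc))

  punchIn-< : ∀ {m} j c → j ≤ m → c < m → punchIn j c < suc m
  punchIn-< zero    c       _         c<m       = s≤s c<m
  punchIn-< (suc j) zero    _         _         = s≤s z≤n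
  punchIn-< (suc j) (suc c) (s≤s j≤m) (s≤s c<m) = s≤s (punchIn-< j c j≤m c<m)

  punchOut-< : ∀ {m j c} → j ≢ c → j < suc m → c < suc m → punchOut j c < m
  punchOut-< {_}     {zero}  {zero}  j≢c _             _             = contradiction refl j≢c
  punchOut-< {_}     {zero}  {suc c} _   _             (s≤s c<m)     = c<m
  punchOut-< {zero}  {suc j} {zero}  _   (s≤s ())      _
  punchOut-< {suc m} {suc j} {zero}  _   _             _             = s≤s z≤n
  punchOut-< {suc m} {suc j} {suc c} j≢c (s≤s j<1+m)   (s≤s c<1+m)   =
    s≤s (punchOut-< (j≢c ∘ cong suc) j<1+m c<1+m)

  punchIn-adjacent : ∀ a c (col : ℕ → ℤ) → col a ≡ col (suc a) →
                     col (punchIn a c) ≡ col (punchIn (suc a) c)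
  punchIn-adjacent zero    zero    col eq = sym eq
  punchIn-adjacent zero    (suc c) col eq = refl
  punchIn-adjacent (suc a) zero    col eq = refl
  punchIn-adjacent (suc a) (suc c) col eq = punchIn-adjacent a c (col ∘ suc) eq

  ∑ : ℕ → (ℕ → ℤ) → ℤ
  ∑ zero    f = 0ℤ
  ∑ (suc m) f = f 0 + ∑ m (λ i → f (suc i))

  ∏ℤ : ℕ → (ℕ → ℤ) → ℤ
  ∏ℤ zero    f = 1ℤ
  ∏ℤ (suc m) f = f 0 * ∏ℤ m (λ i → f (suc i))

  ∑-cong : ∀ m {f g : ℕ → ℤ} → (∀ i → i < m → f i ≡ g i) → ∑ m f ≡ ∑ m g
  ∑-cong zero    f≗g = refl
  ∑-cong (suc m) f≗g = cong₂ _+_ (f≗g 0 (s≤s z≤n)) (∑-cong m (λ i i<m → f≗g (suc i) (s≤s i<m)))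

  ∑-zero : ∀ m {f : ℕ → ℤ} → (∀ i → i < m → f i ≡ 0ℤ) → ∑ m f ≡ 0ℤ
  ∑-zero zero    f≗0 = refl
  ∑-zero (suc m) f≗0 = cong₂ _+_ (f≗0 0 (s≤s z≤n)) (∑-zero m (λ i i<m → f≗0 (suc i) (s≤s i<m)))

  ∑-linear : ∀ m (x y : ℤ) (f g : ℕ → ℤ) → ∑ m (λ i → x * f i + y * g i) ≡ x * ∑ m f + y * ∑ m g
  ∑-linear zero    x y f g = sym (cong₂ _+_ (*-zeroʳ x) (*-zeroʳ y))
  ∑-linear (suc m) x y f g =
    trans (cong (_+_ (x * f 0 + y * g 0)) (∑-linear m x y (λ i → f (suc i)) (λ i → g (suc i))))
          (regroup x y (f 0) (g 0) _ _)
    where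
    regroup : ∀ x y a b s t → x * a + y * b + (x * s + y * t) ≡ x * (a + s) + y * (b + t)
    regroup = solve-∀

  ∑-*ˡ : ∀ m (x : ℤ) (f : ℕ → ℤ) → ∑ m (λ i → x * f i) ≡ x * ∑ m f
  ∑-*ˡ zero    x f = sym (*-zeroʳ x)
  ∑-*ˡ (suc m) x f = trans (cong (_+_ (x * f 0)) (∑-*ˡ m x (f ∘ suc))) (sym (*-distribˡ-+ x (f 0) _))

  ∑-adjacentCancel : ∀ m a {f : ℕ → ℤ} → suc a < m →
    (∀ j → j < m → j ≢ a → j ≢ suc a → f j ≡ 0ℤ) → f a + f (suc a) ≡ 0ℤ → ∑ m f ≡ 0ℤ
  ∑-adjacentCancel (suc (suc m)) zero {f} _ others pair = begin
      f 0 + (f 1 + ∑ m (λ i → f (suc (suc i))))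
    ≡⟨ cong (λ s → f 0 + (f 1 + s))
         (∑-zero m (λ i i<m → others (suc (suc i)) (s≤s (s≤s i<m)) (λ ()) (λ ()))) ⟩
      f 0 + (f 1 + 0ℤ)
    ≡⟨ cong (_+_ (f 0)) (+-identityʳ (f 1)) ⟩
      f 0 + f 1
    ≡⟨ pair ⟩
      0ℤ
    ∎
  ∑-adjacentCancel (suc m) (suc a) (s≤s 2+a≤m) others pair =
    cong₂ _+_ (others 0 (s≤s z≤n) (λ ()) (λ ()))
      (∑-adjacentCancel m a 2+a≤m
        (λ j j<m j≢a j≢1+a → others (suc j) (s≤s j<m) (j≢a ∘ suc-injective) (j≢1+a ∘ suc-injective)) pair)

  ∏ℤ-cong : ∀ m {f g : ℕ → ℤ} → (∀ i → f i ≡ g i) → ∏ℤ m f ≡ ∏ℤ m g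
  ∏ℤ-cong zero    f≗g = refl
  ∏ℤ-cong (suc m) f≗g = cong₂ _*_ (f≗g 0) (∏ℤ-cong m (λ i → f≗g (suc i)))

  ∏ℤ-+ : ∀ m (f : ℕ → ℕ) → ∏ℤ m (λ i → + f i) ≡ + ∏ m f
  ∏ℤ-+ zero    f = refl
  ∏ℤ-+ (suc m) f = trans (cong (+ f 0 *_) (∏ℤ-+ m (λ i → f (suc i)))) (sym (pos-* (f 0) _))

  sign : ℕ → ℤ
  sign j = -1ℤ ^ j

  minor : ℕ → Matrix → Matrix
  minor j M r c = M (suc r) (punchIn j c)

  detℕ : ℕ → Matrix → ℤ
  detℕ zero    M = 1ℤ
  detℕ (suc m) M = ∑ (suc m) (λ j → sign j * (M 0 j * detℕ m (minor j M)))

  detℕ-cong : ∀ m {M N : Matrix} → (∀ i j → i < m → j < m → M i j ≡ N i j) → detℕ m M ≡ detℕ m N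
  detℕ-cong zero    M≈N = refl
  detℕ-cong (suc m) M≈N = ∑-cong (suc m) λ j j<1+m →
    cong₂ (λ a D → sign j * (a * D)) (M≈N 0 j (s≤s z≤n) j<1+m)
      (detℕ-cong m (λ r c r<m c<m → M≈N (suc r) (punchIn j c) (s≤s r<m) (punchIn-< j c (≤-pred j<1+m) c<m)))

  detℕ-ext : ∀ m {M N : Matrix} → (∀ i j → M i j ≡ N i j) → detℕ m M ≡ detℕ m N
  detℕ-ext m M≈N = detℕ-cong m (λ i j _ _ → M≈N i j)

  detℕ-scaleRows : ∀ m (s : ℕ → ℤ) (M : Matrix) → detℕ m (λ i j → s i * M i j) ≡ ∏ℤ m s * detℕ m M
  detℕ-scaleRows zero    s M = sym (*-identityˡ 1ℤ)
  detℕ-scaleRows (suc m) s M = begin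
      ∑ (suc m) (λ j → sign j * (s 0 * M 0 j * detℕ m (λ r c → s (suc r) * minor j M r c)))
    ≡⟨ ∑-cong (suc m) (λ j _ →
         cong (λ D → sign j * (s 0 * M 0 j * D)) (detℕ-scaleRows m (s ∘ suc) (minor j M))) ⟩
      ∑ (suc m) (λ j → sign j * (s 0 * M 0 j * (∏ℤ m (s ∘ suc) * detℕ m (minor j M))))
    ≡⟨ ∑-cong (suc m) (λ j _ → regroup (sign j) (s 0) (M 0 j) (∏ℤ m (s ∘ suc)) (detℕ m (minor j M))) ⟩
      ∑ (suc m) (λ j → ∏ℤ (suc m) s * (sign j * (M 0 j * detℕ m (minor j M))))
    ≡⟨ ∑-*ˡ (suc m) (∏ℤ (suc m) s) (λ j → sign j * (M 0 j * detℕ m (minor j M))) ⟩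
      ∏ℤ (suc m) s * detℕ (suc m) M
    ∎
    where
    regroup : ∀ σ a b p D → σ * (a * b * (p * D)) ≡ a * p * (σ * (b * D))
    regroup = solve-∀

  detℕ-firstRow : ∀ m (M : Matrix) → (∀ j → M 0 (suc j) ≡ 0ℤ) →
    detℕ (suc m) M ≡ M 0 0 * detℕ m (λ i j → M (suc i) (suc j))
  detℕ-firstRow m M row₀ = begin
      sign 0 * (M 0 0 * detℕ m (minor 0 M)) + ∑ m (λ j → sign (suc j) * (M 0 (suc j) * D j))
    ≡⟨ cong (_+_ (sign 0 * (M 0 0 * detℕ m (minor 0 M))))
         (∑-zero m (λ j _ → trans (cong (λ a → sign (suc j) * (a * D j)) (row₀ j)) (*-zeroʳ (sign (suc j))))) ⟩
      sign 0 * (M 0 0 * detℕ m (minor 0 M)) + 0ℤ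
    ≡⟨ trans (+-identityʳ _) (*-identityˡ _) ⟩
      M 0 0 * detℕ m (λ i j → M (suc i) (suc j))
    ∎
    where
    D : ℕ → ℤ
    D j = detℕ m (minor (suc j) M)

  detℕ-linearInColumn : ∀ m c {L M N : Matrix} (x y : ℤ) → c < m →
    (∀ i j → j ≢ c → L i j ≡ M i j) → (∀ i j → j ≢ c → M i j ≡ N i j) →
    (∀ i → L i c ≡ x * M i c + y * N i c) →
    detℕ m L ≡ x * detℕ m M + y * detℕ m N
  detℕ-linearInColumn (suc m) c {L} {M} {N} x y c<1+m L≈M M≈N Lc = begin
      ∑ (suc m) (term L)
    ≡⟨ ∑-cong (suc m) expand ⟩
      ∑ (suc m) (λ j → x * term M j + y * term N j)
    ≡⟨ ∑-linear (suc m) x y (term M) (term N) ⟩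
      x * detℕ (suc m) M + y * detℕ (suc m) N
    ∎
    where
    term : Matrix → ℕ → ℤ
    term A j = sign j * (A 0 j * detℕ m (minor j A))
    expand : ∀ j → j < suc m → term L j ≡ x * term M j + y * term N j
    expand j j<1+m with j ≟ c
    ... | yes refl = begin
        sign j * (L 0 j * detℕ m (minor j L))
      ≡⟨ cong₂ (λ a D → sign j * (a * D)) (Lc 0)
           (detℕ-ext m (λ r c′ → L≈M (suc r) _ (punchInᵢ≢i j c′))) ⟩
        sign j * ((x * M 0 j + y * N 0 j) * detℕ m (minor j M))
      ≡⟨ distribute x y (sign j) (M 0 j) (N 0 j) (detℕ m (minor j M)) ⟩
        x * term M j + y * (sign j * (N 0 j * detℕ m (minor j M)))
      ≡⟨ cong (λ D → x * term M j + y * (sign j * (N 0 j * D)))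
           (detℕ-ext m (λ r c′ → M≈N (suc r) _ (punchInᵢ≢i j c′))) ⟩
        x * term M j + y * term N j
      ∎
      where
      distribute : ∀ x y σ a b D → σ * ((x * a + y * b) * D) ≡ x * (σ * (a * D)) + y * (σ * (b * D))
      distribute = solve-∀
    ... | no j≢c = begin
        sign j * (L 0 j * detℕ m (minor j L))
      ≡⟨ cong₂ (λ a D → sign j * (a * D)) (L≈M 0 j j≢c)
           (detℕ-linearInColumn m (punchOut j c) x y (punchOut-< j≢c j<1+m c<1+m)
             (λ r c′ c′≢ → L≈M (suc r) _ (avoids c′≢))
             (λ r c′ c′≢ → M≈N (suc r) _ (avoids c′≢))
             (λ r → subst (λ col → L (suc r) col ≡ x * M (suc r) col + y * N (suc r) col)
                      (sym (punchIn-punchOut j≢c)) (Lc (suc r)))) ⟩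
        sign j * (M 0 j * (x * detℕ m (minor j M) + y * detℕ m (minor j N)))
      ≡⟨ distribute x y (sign j) (M 0 j) (detℕ m (minor j M)) (detℕ m (minor j N)) ⟩
        x * term M j + y * (sign j * (M 0 j * detℕ m (minor j N)))
      ≡⟨ cong (λ a → x * term M j + y * (sign j * (a * detℕ m (minor j N)))) (M≈N 0 j j≢c) ⟩
        x * term M j + y * term N j
      ∎
      where
      avoids : ∀ {c′} → c′ ≢ punchOut j c → punchIn j c′ ≢ c
      avoids {c′} c′≢ eq = c′≢ (trans (sym (punchOut-punchIn j c′)) (cong (punchOut j) eq))
      distribute : ∀ x y σ a D E → σ * (a * (x * D + y * E)) ≡ x * (σ * (a * D)) + y * (σ * (a * E))
      distribute = solve-∀

  detℕ-adjacentColumns : ∀ m a (M : Matrix) → suc a < m → (∀ i → M i a ≡ M i (suc a)) → detℕ m M ≡ 0ℤ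
  detℕ-adjacentColumns (suc m) a M 1+a<1+m same = ∑-adjacentCancel (suc m) a 1+a<1+m others pair
    where
    term : ℕ → ℤ
    term j = sign j * (M 0 j * detℕ m (minor j M))
    others : ∀ j → j < suc m → j ≢ a → j ≢ suc a → term j ≡ 0ℤ
    others j j<1+m j≢a j≢1+a = begin
        sign j * (M 0 j * detℕ m (minor j M))
      ≡⟨ cong (λ D → sign j * (M 0 j * D)) (detℕ-adjacentColumns m (punchOut j a) (minor j M) bound sameMinor) ⟩
        sign j * (M 0 j * 0ℤ)
      ≡⟨ trans (cong (sign j *_) (*-zeroʳ (M 0 j))) (*-zeroʳ (sign j)) ⟩
        0ℤ
      ∎
      where
      shift : punchOut j (suc a) ≡ suc (punchOut j a)
      shift = punchOut-suc j≢a j≢1+a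
      bound : suc (punchOut j a) < m
      bound = subst (_< m) shift (punchOut-< j≢1+a j<1+m 1+a<1+m)
      sameMinor : ∀ r → minor j M r (punchOut j a) ≡ minor j M r (suc (punchOut j a))
      sameMinor r = begin
          M (suc r) (punchIn j (punchOut j a))
        ≡⟨ cong (M (suc r)) (punchIn-punchOut j≢a) ⟩
          M (suc r) a
        ≡⟨ same (suc r) ⟩
          M (suc r) (suc a)
        ≡⟨ cong (M (suc r)) (trans (cong (punchIn j) (sym shift)) (punchIn-punchOut j≢1+a)) ⟨
          M (suc r) (punchIn j (suc (punchOut j a)))
        ∎
    pair : term a + term (suc a) ≡ 0ℤ
    pair = begin
        term a + sign (suc a) * (M 0 (suc a) * detℕ m (minor (suc a) M))
      ≡⟨ cong₂ (λ b D → term a + sign (suc a) * (b * D)) (sym (same 0))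
           (detℕ-ext m (λ r c → sym (punchIn-adjacent a c (M (suc r)) (same (suc r))))) ⟩
        sign a * (M 0 a * detℕ m (minor a M)) + -1ℤ * sign a * (M 0 a * detℕ m (minor a M))
      ≡⟨ cancel (sign a) (M 0 a * detℕ m (minor a M)) ⟩
        0ℤ
      ∎
      where
      cancel : ∀ σ t → σ * t + -1ℤ * σ * t ≡ 0ℤ
      cancel = solve-∀

  setColumn : ℕ → (ℕ → ℤ) → Matrix → Matrix
  setColumn c u M i j with j ≟ c
  ... | yes _ = u i
  ... | no  _ = M i j

  setColumn-≡ : ∀ c u (M : Matrix) i → setColumn c u M i c ≡ u i
  setColumn-≡ c u M i with c ≟ c
  ... | yes _   = refl
  ... | no  c≢c = contradiction refl c≢c

  setColumn-≢ : ∀ {c j} u (M : Matrix) i → j ≢ c → setColumn c u M i j ≡ M i j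
  setColumn-≢ {c} {j} u M i j≢c with j ≟ c
  ... | yes j≡c = contradiction j≡c j≢c
  ... | no  _   = refl

  -- Linearity splits off the matrix whose columns a and a + 1 are both column a of M.
  detℕ-addToColumn : ∀ m a {L M : Matrix} (x y : ℤ) → suc a < m →
    (∀ i j → j ≢ suc a → L i j ≡ M i j) → (∀ i → L i (suc a) ≡ x * M i (suc a) + y * M i a) →
    detℕ m L ≡ x * detℕ m M
  detℕ-addToColumn m a {L} {M} x y 1+a<m L≈M La = begin
      detℕ m L
    ≡⟨ detℕ-linearInColumn m (suc a) x y 1+a<m L≈M (λ i j j≢ → sym (setColumn-≢ _ M i j≢))
         (λ i → trans (La i) (cong (_+_ (x * M i (suc a))) (cong (y *_) (sym (setColumn-≡ (suc a) _ M i))))) ⟩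
      x * detℕ m M + y * detℕ m N
    ≡⟨ cong (λ D → x * detℕ m M + y * D) (detℕ-adjacentColumns m a N 1+a<m
         (λ i → trans (setColumn-≢ _ M i (<⇒≢ (n<1+n a))) (sym (setColumn-≡ (suc a) _ M i)))) ⟩
      x * detℕ m M + y * 0ℤ
    ≡⟨ trans (cong (_+_ (x * detℕ m M)) (*-zeroʳ y)) (+-identityʳ _) ⟩
      x * detℕ m M
    ∎
    where
    N : Matrix
    N = setColumn (suc a) (λ i → M i a) M

  combineColumns : (x y : ℕ → ℤ) → Matrix → Matrix
  combineColumns x y M i zero    = M i zero
  combineColumns x y M i (suc j) = x j * M i (suc j) + y j * M i j

  combineColumnsAbove : ℕ → (x y : ℕ → ℤ) → Matrix → Matrix
  combineColumnsAbove t x y M i j with j ≤? t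
  ... | yes _ = M i j
  ... | no  _ = combineColumns x y M i j

  combineColumnsAbove-≤ : ∀ {t j} x y (M : Matrix) i → j ≤ t → combineColumnsAbove t x y M i j ≡ M i j
  combineColumnsAbove-≤ {t} {j} x y M i j≤t with j ≤? t
  ... | yes _   = refl
  ... | no  j≰t = contradiction j≤t j≰t

  combineColumnsAbove-> : ∀ {t j} x y (M : Matrix) i → t < j →
                          combineColumnsAbove t x y M i j ≡ combineColumns x y M i j
  combineColumnsAbove-> {t} {j} x y M i t<j with j ≤? t
  ... | yes j≤t = contradiction j≤t (ℕₚ.<⇒≱ t<j)
  ... | no  _   = refl

  -- Columns are combined right to left, so each step only reads columns that are still unchanged.
  detℕ-combineColumnsAbove : ∀ m r t x y (M : Matrix) → suc (t ℕ.+ r) ≡ m →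
    detℕ m (combineColumnsAbove t x y M) ≡ ∏ℤ r (λ s → x (t ℕ.+ s)) * detℕ m M
  detℕ-combineColumnsAbove m zero t x y M refl = trans
    (detℕ-cong m (λ i j _ j<m →
      combineColumnsAbove-≤ x y M i (≤-pred (subst (j <_) (cong suc (ℕₚ.+-identityʳ t)) j<m))))
    (sym (*-identityˡ _))
  detℕ-combineColumnsAbove m (suc r) t x y M refl = begin
      detℕ m (combineColumnsAbove t x y M)
    ≡⟨ detℕ-addToColumn m t (x t) (y t) 1+t<m agree column ⟩
      x t * detℕ m (combineColumnsAbove (suc t) x y M)
    ≡⟨ cong (x t *_) (detℕ-combineColumnsAbove m r (suc t) x y M (cong suc (sym (ℕₚ.+-suc t r)))) ⟩
      x t * (∏ℤ r (λ s → x (suc t ℕ.+ s)) * detℕ m M)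
    ≡⟨ sym (*-assoc (x t) _ _) ⟩
      x t * ∏ℤ r (λ s → x (suc t ℕ.+ s)) * detℕ m M
    ≡⟨ cong (_* detℕ m M)
         (cong₂ _*_ (cong x (sym (ℕₚ.+-identityʳ t))) (∏ℤ-cong r (λ s → cong x (sym (ℕₚ.+-suc t s))))) ⟩
      ∏ℤ (suc r) (λ s → x (t ℕ.+ s)) * detℕ m M
    ∎
    where
    1+t<m : suc t < m
    1+t<m = s≤s (subst (suc t ≤_) (sym (ℕₚ.+-suc t r)) (s≤s (ℕₚ.m≤m+n t r)))
    agree : ∀ i j → j ≢ suc t → combineColumnsAbove t x y M i j ≡ combineColumnsAbove (suc t) x y M i j
    agree i j j≢1+t with ℕₚ.≤-<-connex j t
    ... | inj₁ j≤t = trans (combineColumnsAbove-≤ x y M i j≤t)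
                      (sym (combineColumnsAbove-≤ x y M i (≤-trans j≤t (n≤1+n t))))
    ... | inj₂ t<j = trans (combineColumnsAbove-> x y M i t<j)
                      (sym (combineColumnsAbove-> x y M i (≤∧≢⇒< t<j (j≢1+t ∘ sym))))
    column : ∀ i → combineColumnsAbove t x y M i (suc t)
                     ≡ x t * combineColumnsAbove (suc t) x y M i (suc t) + y t * combineColumnsAbove (suc t) x y M i t
    column i = begin
        combineColumnsAbove t x y M i (suc t)
      ≡⟨ combineColumnsAbove-> x y M i (n<1+n t) ⟩
        x t * M i (suc t) + y t * M i t
      ≡⟨ cong₂ (λ a b → x t * a + y t * b) (sym (combineColumnsAbove-≤ x y M i ℕₚ.≤-refl))
                                           (sym (combineColumnsAbove-≤ x y M i (n≤1+n t))) ⟩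
        x t * combineColumnsAbove (suc t) x y M i (suc t) + y t * combineColumnsAbove (suc t) x y M i t
      ∎

  detℕ-combineColumns : ∀ d x y (M : Matrix) → detℕ (suc d) (combineColumns x y M) ≡ ∏ℤ d x * detℕ (suc d) M
  detℕ-combineColumns d x y M =
    trans (detℕ-ext (suc d) above₀) (detℕ-combineColumnsAbove (suc d) d 0 x y M refl)
    where
    above₀ : ∀ i j → combineColumns x y M i j ≡ combineColumnsAbove 0 x y M i j
    above₀ i zero    = sym (combineColumnsAbove-≤ x y M i (z≤n {0}))
    above₀ i (suc j) = sym (combineColumnsAbove-> x y M i (s≤s z≤n))

  toℕ-punchIn : ∀ {m} (j : Fin (suc m)) (c : Fin m) → toℕ (Fin.punchIn j c) ≡ punchIn (toℕ j) (toℕ c)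
  toℕ-punchIn Fin.zero    c           = refl
  toℕ-punchIn (Fin.suc j) Fin.zero    = refl
  toℕ-punchIn (Fin.suc j) (Fin.suc c) = cong suc (toℕ-punchIn j c)

  sumFin≡∑ : ∀ m (f : Fin m → ℤ) (g : ℕ → ℤ) → (∀ j → f j ≡ g (toℕ j)) → sumFin m f ≡ ∑ m g
  sumFin≡∑ zero    f g f≈g = refl
  sumFin≡∑ (suc m) f g f≈g =
    cong₂ _+_ (f≈g Fin.zero) (sumFin≡∑ m (f ∘ Fin.suc) (g ∘ suc) (f≈g ∘ Fin.suc))

  det≡detℕ : ∀ m (M : Fin m → Fin m → ℤ) (N : Matrix) →
             (∀ i j → M i j ≡ N (toℕ i) (toℕ j)) → det m M ≡ detℕ m N
  det≡detℕ zero    M N M≈N = refl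
  det≡detℕ (suc m) M N M≈N = sumFin≡∑ (suc m) _ (λ j → sign j * (N 0 j * detℕ m (minor j N))) λ j →
    cong₂ (λ a D → sign (toℕ j) * (a * D)) (M≈N Fin.zero j)
      (det≡detℕ m _ (minor (toℕ j) N) λ r c →
        trans (M≈N (Fin.suc r) (Fin.punchIn j c)) (cong (N (suc (toℕ r))) (toℕ-punchIn j c)))

open Determinants

module BinomialDeterminant where

  open import Data.Nat as ℕ using ()
  open import Data.Nat.Combinatorics using (_C_)
  open import Data.Integer using (ℤ; +_; _+_; _-_; _*_)
  open import Data.Integer.Properties using (*-zeroˡ; pos-*)
  open import Data.Integer.Tactic.RingSolver using (solve-∀)
  open ≡-Reasoning

  binomialℕ : ℕ → ℕ → Matrix
  binomialℕ n k i j = + ((n ℕ.+ i) C (k ℕ.+ j))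

  combineColumns-binomial : ∀ n k i j →
    combineColumns (λ j → + suc (k ℕ.+ j)) (λ j → + (k ℕ.+ j) - + n) (binomialℕ n k) i (suc j)
      ≡ + i * binomialℕ n k i j
  combineColumns-binomial n k i j = begin
      + suc K * + ((n ℕ.+ i) C (k ℕ.+ suc j)) + (+ K - + n) * + (N C K)
    ≡⟨ cong (λ K′ → + suc K * + (N C K′) + (+ K - + n) * + (N C K)) (ℕₚ.+-suc k j) ⟩
      + suc K * + (N C suc K) + (+ K - + n) * + (N C K)
    ≡⟨ absorb (+ suc K * + (N C suc K)) (+ K) (+ n) (+ i) (+ (N C K)) pascal ⟩
      + i * + (N C K)
    ∎
    where
    N K : ℕ
    N = n ℕ.+ i
    K = k ℕ.+ j
    pascal : + suc K * + (N C suc K) + + K * + (N C K) ≡ + N * + (N C K)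
    pascal = begin
        + suc K * + (N C suc K) + + K * + (N C K)
      ≡⟨ cong₂ _+_ (pos-* (suc K) (N C suc K)) (pos-* K (N C K)) ⟨
        + (suc K ℕ.* (N C suc K) ℕ.+ K ℕ.* (N C K))
      ≡⟨ cong +_ ([1+k]*nC[1+k]+k*nCk≡n*nCk N K) ⟩
        + (N ℕ.* (N C K))
      ≡⟨ pos-* N (N C K) ⟩
        + N * + (N C K)
      ∎
    absorb : ∀ a K n i c → a + K * c ≡ (n + i) * c → a + (K - n) * c ≡ i * c
    absorb a K n i c eq = begin
        a + (K - n) * c
      ≡⟨ expand a K n c ⟩
        a + K * c - n * c
      ≡⟨ cong (_- n * c) eq ⟩
        (n + i) * c - n * c
      ≡⟨ collapse n i c ⟩
        i * c
      ∎
      where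
      expand : ∀ a K n c → a + (K - n) * c ≡ a + K * c - n * c
      expand = solve-∀
      collapse : ∀ n i c → (n + i) * c - n * c ≡ i * c
      collapse = solve-∀

  detℕ-binomial-reduce : ∀ d n k →
    ∏ℤ d (λ j → + suc (k ℕ.+ j)) * detℕ (suc d) (binomialℕ n k)
      ≡ + (n C k) * (∏ℤ d (λ i → + suc i) * detℕ d (binomialℕ (suc n) k))
  detℕ-binomial-reduce d n k = begin
      ∏ℤ d x * detℕ (suc d) (binomialℕ n k)
    ≡⟨ detℕ-combineColumns d x y (binomialℕ n k) ⟨
      detℕ (suc d) B′
    ≡⟨ detℕ-firstRow d B′ (λ j → trans (combineColumns-binomial n k 0 j) (*-zeroˡ (binomialℕ n k 0 j))) ⟩
      binomialℕ n k 0 0 * detℕ d (λ i j → B′ (suc i) (suc j))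
    ≡⟨ cong₂ _*_ (cong₂ (λ a b → + (a C b)) (ℕₚ.+-identityʳ n) (ℕₚ.+-identityʳ k))
                 (detℕ-ext d rows) ⟩
      + (n C k) * detℕ d (λ i j → + suc i * binomialℕ (suc n) k i j)
    ≡⟨ cong (_*_ (+ (n C k))) (detℕ-scaleRows d (λ i → + suc i) (binomialℕ (suc n) k)) ⟩
      + (n C k) * (∏ℤ d (λ i → + suc i) * detℕ d (binomialℕ (suc n) k))
    ∎
    where
    x y : ℕ → ℤ
    x j = + suc (k ℕ.+ j)
    y j = + (k ℕ.+ j) - + n
    B′ : Matrix
    B′ = combineColumns x y (binomialℕ n k)
    rows : ∀ i j → B′ (suc i) (suc j) ≡ + suc i * binomialℕ (suc n) k i j
    rows i j = trans (combineColumns-binomial n k (suc i) j)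
                     (cong (λ m → + suc i * + (m C (k ℕ.+ j))) (ℕₚ.+-suc n i))

open BinomialDeterminant

module DnomialDeterminant where

  open import Data.Nat as ℕ using (zero; _^_; _!)
  open import Data.Nat.Combinatorics using (_C_)
  open import Data.Integer using (ℤ; +_; _*_)
  open import Data.Integer.Properties using (pos-*; *-cancelˡ-≡; *-identityʳ; *-assoc)
  open import Data.Integer.Tactic.RingSolver using (solve-∀)
  open ≡-Reasoning

  detℕ-binomial-suc : ∀ d n k →
    + ((k ℕ.+ d) !) * detℕ (suc d) (binomialℕ n k)
      ≡ + ((n C k) ℕ.* k !) * + (d !) * detℕ d (binomialℕ (suc n) k)
  detℕ-binomial-suc d n k = begin
      + ((k ℕ.+ d) !) * X
    ≡⟨ cong (λ m → + m * X) (∏[1+a+i]*a!≡[a+m]! k d) ⟨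
      + (Q ℕ.* k !) * X
    ≡⟨ cong (_* X) (trans (pos-* Q (k !)) (cong (_* + (k !)) (sym (∏ℤ-+ d (λ j → suc (k ℕ.+ j)))))) ⟩
      ∏ℤ d (λ j → + suc (k ℕ.+ j)) * + (k !) * X
    ≡⟨ swap (∏ℤ d (λ j → + suc (k ℕ.+ j))) (+ (k !)) X ⟩
      + (k !) * (∏ℤ d (λ j → + suc (k ℕ.+ j)) * X)
    ≡⟨ cong (_*_ (+ (k !))) (detℕ-binomial-reduce d n k) ⟩
      + (k !) * (+ (n C k) * (∏ℤ d (λ i → + suc i) * Y))
    ≡⟨ cong (λ p → + (k !) * (+ (n C k) * (p * Y))) (trans (∏ℤ-+ d suc) (cong +_ ∏[1+i]≡d!)) ⟩
      + (k !) * (+ (n C k) * (+ (d !) * Y))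
    ≡⟨ regroup (+ (k !)) (+ (n C k)) (+ (d !)) Y ⟩
      + (n C k) * + (k !) * + (d !) * Y
    ≡⟨ cong (λ c → c * + (d !) * Y) (pos-* (n C k) (k !)) ⟨
      + ((n C k) ℕ.* k !) * + (d !) * Y
    ∎
    where
    X Y : ℤ
    X = detℕ (suc d) (binomialℕ n k)
    Y = detℕ d (binomialℕ (suc n) k)
    Q : ℕ
    Q = ∏ d (λ j → suc (k ℕ.+ j))
    ∏[1+i]≡d! : ∏ d suc ≡ d !
    ∏[1+i]≡d! = trans (sym (ℕₚ.*-identityʳ (∏ d suc))) (∏[1+a+i]*a!≡[a+m]! 0 d)
    swap : ∀ q f x → q * f * x ≡ f * (q * x)
    swap = solve-∀
    regroup : ∀ f c e y → f * (c * (e * y)) ≡ c * f * e * y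
    regroup = solve-∀

  ∏⟨⟩*detℕ-binomial : ∀ d {n} k → k ≤ n →
                      + ∏⟨⟩ d k k * detℕ d (binomialℕ n k) ≡ + ∏⟨⟩ d n k
  ∏⟨⟩*detℕ-binomial zero    k _   = *-identityʳ _
  ∏⟨⟩*detℕ-binomial (suc d) {n} k k≤n = *-cancelˡ-≡ (+ (F ℕ.* p)) _ _ (begin
      + (F ℕ.* p) * (+ D′ * X)
    ≡⟨ cong (_* (+ D′ * X)) (pos-* F p) ⟩
      + F * + p * (+ D′ * X)
    ≡⟨ regroup₁ (+ F) (+ p) (+ D′) X ⟩
      + D′ * + p * (+ F * X)
    ≡⟨ cong (_*_ (+ D′ * + p)) (detℕ-binomial-suc d n k) ⟩
      + D′ * + p * (+ c * + (d !) * Y)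
    ≡⟨ regroup₂ (+ D′ * + p) (+ c) (+ (d !)) Y ⟩
      + D′ * + p * + (d !) * (+ c * Y)
    ≡⟨ cong (_* (+ c * Y)) denominator ⟩
      + F * + D * (+ c * Y)
    ≡⟨ regroup₃ (+ F) (+ D) (+ c) Y ⟩
      + F * + c * (+ D * Y)
    ≡⟨ cong (_*_ (+ F * + c)) (∏⟨⟩*detℕ-binomial d k (ℕₚ.m≤n⇒m≤1+n k≤n)) ⟩
      + F * + c * + N
    ≡⟨ numerator ⟩
      + F * (+ N′ * + p)
    ≡⟨ regroup₄ (+ F) (+ N′) (+ p) ⟩
      + F * + p * + N′
    ≡⟨ cong (_* + N′) (pos-* F p) ⟨
      + (F ℕ.* p) * + N′
    ∎)
    where
    F p c D′ N′ D N : ℕ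
    F = (k ℕ.+ d) !
    p = suc d ^ k
    c = (n C k) ℕ.* k !
    D′ = ∏⟨⟩ (suc d) k k
    N′ = ∏⟨⟩ (suc d) n k
    D = ∏⟨⟩ d k k
    N = ∏⟨⟩ d (suc n) k
    X Y : ℤ
    X = detℕ (suc d) (binomialℕ n k)
    Y = detℕ d (binomialℕ (suc n) k)
    instance
      F*p≢0 : ℕ.NonZero (F ℕ.* p)
      F*p≢0 = ℕₚ.m*n≢0 F p {{ℕₚ._!≢0 (k ℕ.+ d)}} {{ℕₚ.m^n≢0 (suc d) k}}
    denominator : + D′ * + p * + (d !) ≡ + F * + D
    denominator = begin
        + D′ * + p * + (d !)
      ≡⟨ cong (_* + (d !)) (pos-* D′ p) ⟨
        + (D′ ℕ.* p) * + (d !)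
      ≡⟨ pos-* (D′ ℕ.* p) (d !) ⟨
        + (D′ ℕ.* p ℕ.* d !)
      ≡⟨ cong +_ (∏⟨⟩-suc-diagonal d k) ⟩
        + (F ℕ.* D)
      ≡⟨ pos-* F D ⟩
        + F * + D
      ∎
    numerator : + F * + c * + N ≡ + F * (+ N′ * + p)
    numerator = trans (*-assoc (+ F) (+ c) (+ N))
      (cong (_*_ (+ F)) (trans (sym (pos-* c N)) (trans (cong +_ (sym (∏⟨⟩-suc d k k≤n))) (pos-* N′ p))))
    regroup₁ : ∀ f q d′ x → f * q * (d′ * x) ≡ d′ * q * (f * x)
    regroup₁ = solve-∀
    regroup₂ : ∀ u c e y → u * (c * e * y) ≡ u * e * (c * y)
    regroup₂ = solve-∀
    regroup₃ : ∀ f d c y → f * d * (c * y) ≡ f * c * (d * y)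
    regroup₃ = solve-∀
    regroup₄ : ∀ f n q → f * (n * q) ≡ f * q * n
    regroup₄ = solve-∀

open DnomialDeterminant

module Fractions where

  open import Data.Nat as ℕ using (zero)
  open import Data.Integer using (+_)
  open import Data.Integer.Properties using (pos-*; *-identityʳ; *-comm)
  open import Data.Rational as ℚ using (_/_)
  import Data.Rational.Properties as ℚₚ
  open import Data.Rational.Unnormalised as ℚᵘ using (mkℚᵘ; *≡*)
  import Data.Rational.Unnormalised.Properties as ℚᵘₚ

  /-*-/ : ∀ p q r s .{{_ : NonZero q}} .{{_ : NonZero s}} →
    (p / q) ℚ.* (r / s) ≡ ((p ℤ.* r) / (q ℕ.* s)) {{ℕₚ.m*n≢0 q s}}
  /-*-/ p (suc q) r (suc s) = ℚₚ.toℚᵘ-injective (begin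
      ℚ.toℚᵘ ((p / suc q) ℚ.* (r / suc s))
    ≈⟨ ℚₚ.toℚᵘ-homo-* (p / suc q) (r / suc s) ⟩
      ℚ.toℚᵘ (p / suc q) ℚᵘ.* ℚ.toℚᵘ (r / suc s)
    ≈⟨ ℚᵘₚ.*-cong (ℚₚ.toℚᵘ-fromℚᵘ (mkℚᵘ p q)) (ℚₚ.toℚᵘ-fromℚᵘ (mkℚᵘ r s)) ⟩
      mkℚᵘ p q ℚᵘ.* mkℚᵘ r s
    ≈⟨ ℚₚ.toℚᵘ-fromℚᵘ (mkℚᵘ p q ℚᵘ.* mkℚᵘ r s) ⟨
      ℚ.toℚᵘ ((p ℤ.* r) / (suc q ℕ.* suc s))
    ∎)
    where open ℚᵘₚ.≃-Reasoning

  [q*c]/q≡c/1 : ∀ p q c .{{_ : NonZero q}} → + q ℤ.* c ≡ p → p / q ≡ c / 1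
  [q*c]/q≡c/1 p (suc q) c q*c≡p = ℚₚ.fromℚᵘ-cong {mkℚᵘ p q} {mkℚᵘ c 0}
    (*≡* (trans (*-identityʳ p) (trans (sym q*c≡p) (*-comm (+ suc q) c))))

  frac≡/ : ∀ a b .{{_ : NonZero b}} → frac a b ≡ + a / b
  frac≡/ a (suc b) = refl

  prodUpTo-frac : ∀ k (a b : ℕ → ℕ) (b≢0 : ∀ j → j < k → NonZero (b j)) →
    prodUpTo k (λ j → frac (a j) (b j)) ≡ (+ ∏ k a / ∏ k b) {{∏-nonZero k b≢0}}
  prodUpTo-frac zero    a b b≢0 = refl
  prodUpTo-frac (suc k) a b b≢0 = begin
      prodUpTo k (λ j → frac (a j) (b j)) ℚ.* frac (a k) (b k)
    ≡⟨ cong₂ ℚ._*_ (prodUpTo-frac k a b (λ j j<k → b≢0 j (ℕₚ.m<n⇒m<1+n j<k)))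
                   (frac≡/ (a k) (b k)) ⟩
      (+ ∏ k a / ∏ k b) ℚ.* (+ a k / b k)
    ≡⟨ /-*-/ (+ ∏ k a) (∏ k b) (+ a k) (b k) ⟩
      (+ ∏ k a ℤ.* + a k) / (∏ k b ℕ.* b k)
    ≡⟨ ℚₚ./-cong (trans (sym (pos-* (∏ k a) (a k))) (cong +_ (sym (∏-last k a)))) (sym (∏-last k b)) ⟩
      + ∏ (suc k) a / ∏ (suc k) b
    ∎
    where
    open ≡-Reasoning
    instance
      ∏b≢0 : NonZero (∏ k b)
      ∏b≢0 = ∏-nonZero k (λ j j<k → b≢0 j (ℕₚ.m<n⇒m<1+n j<k))
      bk≢0 : NonZero (b k)
      bk≢0 = b≢0 k ℕₚ.≤-refl
      ∏b*bk≢0 : NonZero (∏ k b ℕ.* b k)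
      ∏b*bk≢0 = ℕₚ.m*n≢0 (∏ k b) (b k)
      ∏b′≢0 : NonZero (∏ (suc k) b)
      ∏b′≢0 = ∏-nonZero (suc k) b≢0

open Fractions

corollary3 : (d n k : ℕ) → 1 ≤ d → k ≤ n →
    dnomial d n k ≡ det d (binomMatrix d n k) / 1
corollary3 d n k _ k≤n = begin
    dnomial d n k
  ≡⟨ prodUpTo-frac k (λ j → ⟨ n ∸ j ⟩[ d ]) (λ j → ⟨ k ∸ j ⟩[ d ]) ⟨k∸j⟩≢0 ⟩
    ℤ.+ ∏⟨⟩ d n k / ∏⟨⟩ d k k
  ≡⟨ [q*c]/q≡c/1 _ _ _ (∏⟨⟩*detℕ-binomial d k k≤n) ⟩
    detℕ d (binomialℕ n k) / 1
  ≡⟨ cong (_/ 1) (det≡detℕ d (binomMatrix d n k) (binomialℕ n k) (λ _ _ → refl)) ⟨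
    det d (binomMatrix d n k) / 1
  ∎
  where
  open ≡-Reasoning
  ⟨k∸j⟩≢0 : ∀ j → j < k → NonZero ⟨ k ∸ j ⟩[ d ]
  ⟨k∸j⟩≢0 j j<k = ⟨a⟩[d]-nonZero d (ℕₚ.m<n⇒0<n∸m j<k)
  instance
    ∏⟨⟩≢0 : NonZero (∏⟨⟩ d k k)
    ∏⟨⟩≢0 = ∏-nonZero k ⟨k∸j⟩≢0
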